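{- Let $n\ge1$, $\mathbf{x}\in\{0,1\}^n$, let $\omega=\omega(\mathbf{x}')$, let $m$ be the number of 1-runs in $\mathbf{x}'$ and $m_1$ the number of these of length $1$. For $j=0,1,2,3,4$ let $A_j$ be the number of sequences $\mathbf{y}\in\Phi_2(\mathbf{x})$ with $\omega(\mathbf{y}')=\omega-j$. Then (a) $A_0+A_1=1+m+\binom{m}{2}$; (b) $A_2+A_3=(\omega-m)(m+1)-(m-m_1)$; (c) $A_4=\binom{\omega-m}{2}-(\omega-m)+(m-m_1)$.
   Context: Let $\Sigma=\{0,1\}$. For $\mathbf{x}=(x_1,\dots,x_n)\in\Sigma^n$, its derivative sequence is $\mathbf{x}'=(x'_2,\dots,x'_n)$ with $x'_j=x_{j-1}\oplus x_j$ (mod 2); $\omega(\cdot)$ denotes Hamming weight. A 1-run is a maximal substring of consecutive 1s. A grain pattern is a subset $E\subseteq\{2,\dots,n\}$ containing no two consecutive integers; $\mathcal{E}_{n,t}$ is the set of grain patterns with $|E|\le t$. For a grain pattern $E$, $\phi_E(\mathbf{x})=\mathbf{y}$ with $y_j=x_{j-1}$ if $j\in E$ and $y_j=x_j$ otherwise. $\Phi_t(\mathbf{x})=\{\phi_E(\mathbf{x}):E\in\mathcal{E}_{n,t}\}$ (a set of sequences, so each $\mathbf{y}$ is counted once). -}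

module Defs where

open import Data.Bool using (Bool; true; false; _∧_; _xor_; if_then_else_; not)
import Data.Bool.Properties as BoolP
open import Data.Nat using (ℕ; zero; suc; _+_; _≤ᵇ_; _≡ᵇ_)
open import Data.List using (List; []; _∷_; length; filter; map; _++_)
open import Data.Bool.ListAction using (any)
open import Data.Vec using (Vec; []; _∷_; toList)
open import Data.Vec.Properties using (≡-dec)
open import Relation.Nullary.Decidable using (⌊_⌋)

-- Binary sequences of length n are Vec Bool n (true = 1, false = 0).
-- Index 1 (paper) is the head of the vector.

-- Derivative sequence x' = (x₂', …, xₙ'), xⱼ' = x_{j-1} ⊕ x_j.
deriv : ∀ {n} → Vec Bool (suc n) → Vec Bool n
deriv {zero}  (a ∷ [])     = []
deriv {suc n} (a ∷ b ∷ xs) = (a xor b) ∷ deriv (b ∷ xs)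

weight : ∀ {n} → Vec Bool n → ℕ
weight []           = 0
weight (true ∷ xs)  = suc (weight xs)
weight (false ∷ xs) = weight xs

runsFrom : ℕ → List Bool → List ℕ
runsFrom zero    []           = []
runsFrom (suc k) []           = suc k ∷ []
runsFrom k       (true ∷ xs)  = runsFrom (suc k) xs
runsFrom zero    (false ∷ xs) = runsFrom zero xs
runsFrom (suc k) (false ∷ xs) = suc k ∷ runsFrom zero xs

runLengths : ∀ {n} → Vec Bool n → List ℕ
runLengths xs = runsFrom zero (toList xs)

numRuns : ∀ {n} → Vec Bool n → ℕ
numRuns xs = length (runLengths xs)

numRuns1 : ∀ {n} → Vec Bool n → ℕ
numRuns1 xs = length (filter (λ k → k Data.Nat.≟ 1) (runLengths xs))

-- A grain pattern E ⊆ {2,…,n} is encoded by its indicator vector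
-- E : Vec Bool n (position j true iff j ∈ E).
-- Boolean test: position 1 not in E, and no two consecutive positions in E.
noAdj : ∀ {n} → Vec Bool n → Bool
noAdj []                = true
noAdj (a ∷ [])          = true
noAdj (a ∷ b ∷ xs)      = not (a ∧ b) ∧ noAdj (b ∷ xs)

isGrain : ∀ {n} → Vec Bool n → Bool
isGrain []       = true
isGrain (e ∷ es) = not e ∧ noAdj (e ∷ es)

inGrainSet : ∀ {n} → ℕ → Vec Bool n → Bool
inGrainSet t E = isGrain E ∧ (weight E ≤ᵇ t)

-- φ_E(x): y_j = x_{j-1} if j ∈ E, else x_j.
-- phiFrom p E x : p is the previous symbol of x.
phiFrom : ∀ {n} → Bool → Vec Bool n → Vec Bool n → Vec Bool n
phiFrom p []       []       = []
phiFrom p (e ∷ es) (a ∷ as) = (if e then p else a) ∷ phiFrom a es as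

phi : ∀ {n} → Vec Bool n → Vec Bool n → Vec Bool n
phi []       []       = []
phi (e ∷ es) (a ∷ as) = a ∷ phiFrom a es as   -- 1 ∉ E for grain patterns

allVecs : (n : ℕ) → List (Vec Bool n)
allVecs zero    = [] ∷ []
allVecs (suc n) = map (false ∷_) (allVecs n) ++ map (true ∷_) (allVecs n)

_==ᵥ_ : ∀ {n} → Vec Bool n → Vec Bool n → Bool
x ==ᵥ y = ⌊ ≡-dec BoolP._≟_ x y ⌋

inPhi : ∀ {n} → ℕ → Vec Bool n → Vec Bool n → Bool
inPhi {n} t x y = any (λ E → inGrainSet t E ∧ (phi E x ==ᵥ y)) (allVecs n)

-- A_j(x) for t = 2: number of distinct y ∈ Φ₂(x) with ω(y') = ω(x') - j,
-- the latter written as ω(y') + j = ω(x') (no truncated subtraction).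
A : ∀ {n} → ℕ → Vec Bool (suc n) → ℕ
A {n} j x = length (filter (λ y → Data.Bool._≟_ (inPhi 2 x y ∧ ((weight (deriv y) + j) ≡ᵇ weight (deriv x))) true)
                           (allVecs (suc n)))

-- Write s = x'. Since φ_E changes x only at the positions i ∈ E with s_i = 1, a sequence y ∈ Φ₂(x)
-- is the same thing as a set D of at most two pairwise non-adjacent 1-positions of s. Changing x at i
-- replaces s_i by 0 and complements s_{i+1}, so ω drops by 2, 0 or 1 according as s_i is followed by
-- a 1, by a 0, or ends s, and non-adjacent changes act independently. Counting the sets D by their
-- total drop, with c₀ = #10, c₂ = #11 and e = [s ends in 1]:
--   A₀ = 1 + c₀ + C(c₀,2),  A₁ = e + c₀ e,  A₂ = c₂ + c₂ c₀ − #110,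
--   A₃ = c₂ e − [s ends in 11],  A₄ = C(c₂,2) − #111,
-- the subtracted terms counting the adjacent pairs. On the other hand ω = m + c₂, m = c₀ + e,
-- m − m₁ = #110 + [s ends in 11] and c₂ = #110 + #111 + [s ends in 11].
module Submission where

open import Defs
open import Data.Bool using (Bool; true; false; _∧_; _xor_; not; if_then_else_; T)
open import Data.List using (List; []; _∷_; _∷ʳ_; length; filter; map; _++_)
open import Data.Vec using (Vec; []; _∷_; toList; zipWith)
open import Data.Nat using (ℕ; zero; suc)
import Data.Nat as ℕ
open import Data.Nat.Combinatorics using (_C_)
open import Data.Product using (_×_; _,_; proj₂)
open import Relation.Binary.PropositionalEquality

module Occurrences where

  open import Data.Nat using (_+_; _≤_; z≤n; s≤s)
  open import Data.Nat.Tactic.RingSolver using (solve-∀)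

  bit : Bool → ℕ
  bit true  = 1
  bit false = 0

  _≈ᵇ_ : List Bool → List Bool → Bool
  []      ≈ᵇ []      = true
  (a ∷ p) ≈ᵇ (b ∷ t) = not (a xor b) ∧ (p ≈ᵇ t)
  _       ≈ᵇ _       = false

  _isPrefixOf_ : List Bool → List Bool → Bool
  []      isPrefixOf t       = true
  (a ∷ p) isPrefixOf []      = false
  (a ∷ p) isPrefixOf (b ∷ t) = not (a xor b) ∧ (p isPrefixOf t)

  occurrences : List Bool → List Bool → ℕ
  occurrences p []      = 0
  occurrences p (b ∷ s) = bit (p isPrefixOf (b ∷ s)) + occurrences p s

  suffixOccurrences : List Bool → List Bool → ℕ
  suffixOccurrences p []      = 0
  suffixOccurrences p (b ∷ s) = bit (p ≈ᵇ (b ∷ s)) + suffixOccurrences p s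

  isPrefixOf-split : ∀ p t → bit (p isPrefixOf t)
    ≡ bit ((p ∷ʳ false) isPrefixOf t) + bit ((p ∷ʳ true) isPrefixOf t) + bit (p ≈ᵇ t)
  isPrefixOf-split []      []          = refl
  isPrefixOf-split []      (false ∷ t) = refl
  isPrefixOf-split []      (true ∷ t)  = refl
  isPrefixOf-split (a ∷ p) []          = refl
  isPrefixOf-split (a ∷ p) (b ∷ t) with not (a xor b)
  ... | true  = isPrefixOf-split p t
  ... | false = refl

  occurrences-split : ∀ p s → occurrences p s
    ≡ occurrences (p ∷ʳ false) s + occurrences (p ∷ʳ true) s + suffixOccurrences p s
  occurrences-split p []      = refl
  occurrences-split p (b ∷ s) =
    trans (cong₂ _+_ (isPrefixOf-split p t) (occurrences-split p s))
          (interchange (bit (p₀ isPrefixOf t)) (bit (p₁ isPrefixOf t)) (bit (p ≈ᵇ t))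
                       (occurrences p₀ s) (occurrences p₁ s) (suffixOccurrences p s))
    where
    t : List Bool
    t = b ∷ s
    p₀ : List Bool
    p₀ = p ∷ʳ false
    p₁ : List Bool
    p₁ = p ∷ʳ true
    interchange : ∀ a b c d e f → (a + b + c) + (d + e + f) ≡ (a + d) + (b + e) + (c + f)
    interchange = solve-∀

  #10 #11 #110 #111 ends1 ends11 : List Bool → ℕ
  #10    = occurrences (true ∷ false ∷ [])
  #11    = occurrences (true ∷ true ∷ [])
  #110   = occurrences (true ∷ true ∷ false ∷ [])
  #111   = occurrences (true ∷ true ∷ true ∷ [])
  ends1  = suffixOccurrences (true ∷ [])
  ends11 = suffixOccurrences (true ∷ true ∷ [])

  ends1≤1 : ∀ s → ends1 s ≤ 1
  ends1≤1 []             = z≤n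
  ends1≤1 (false ∷ s)    = ends1≤1 s
  ends1≤1 (true ∷ [])    = s≤s z≤n
  ends1≤1 (true ∷ b ∷ s) = ends1≤1 (b ∷ s)

  weight≡occurrences : ∀ {n} (v : Vec Bool n) → weight v ≡ occurrences (true ∷ []) (toList v)
  weight≡occurrences []          = refl
  weight≡occurrences (true ∷ v)  = cong suc (weight≡occurrences v)
  weight≡occurrences (false ∷ v) = weight≡occurrences v

open Occurrences

module Runs where

  open import Data.Nat using (_+_)
  open import Data.Nat.Properties using (+-suc; +-assoc)
  open import Data.Nat.Tactic.RingSolver using (solve-∀)

  length-runsFrom-suc : ∀ k s → length (runsFrom (suc k) s) ≡ length (runsFrom 1 s)
  length-runsFrom-suc k []          = refl
  length-runsFrom-suc k (true ∷ s)  = trans (length-runsFrom-suc (suc k) s) (sym (length-runsFrom-suc 1 s))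
  length-runsFrom-suc k (false ∷ s) = refl

  mutual
    length-runsFrom : ∀ s → length (runsFrom 0 s) ≡ #10 s + ends1 s
    length-runsFrom []          = refl
    length-runsFrom (false ∷ s) = length-runsFrom s
    length-runsFrom (true ∷ s)  = length-runsFrom-1 s

    length-runsFrom-1 : ∀ s → length (runsFrom 1 s) ≡ #10 (true ∷ s) + ends1 (true ∷ s)
    length-runsFrom-1 []          = refl
    length-runsFrom-1 (false ∷ s) = cong suc (length-runsFrom s)
    length-runsFrom-1 (true ∷ s)  = trans (length-runsFrom-suc 1 s) (length-runsFrom-1 s)

  singleRuns : ℕ → List Bool → ℕ
  singleRuns k s = length (filter (λ ℓ → ℓ ℕ.≟ 1) (runsFrom k s))

  singleRuns-suc : ∀ k s → singleRuns (2 + k) s ≡ singleRuns 2 s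
  singleRuns-suc k []          = refl
  singleRuns-suc k (true ∷ s)  = trans (singleRuns-suc (suc k) s) (sym (singleRuns-suc 1 s))
  singleRuns-suc k (false ∷ s) = refl

  mutual
    singleRuns+longRuns : ∀ s → singleRuns 0 s + #110 s + ends11 s ≡ #10 s + ends1 s
    singleRuns+longRuns []          = refl
    singleRuns+longRuns (false ∷ s) = singleRuns+longRuns s
    singleRuns+longRuns (true ∷ s)  = singleRuns+longRuns-1 s

    singleRuns+longRuns-1 : ∀ s →
      singleRuns 1 s + #110 (true ∷ s) + ends11 (true ∷ s) ≡ #10 (true ∷ s) + ends1 (true ∷ s)
    singleRuns+longRuns-1 []          = refl
    singleRuns+longRuns-1 (false ∷ s) = cong suc (singleRuns+longRuns s)
    singleRuns+longRuns-1 (true ∷ s)  = singleRuns+longRuns-2 s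

    singleRuns+longRuns-2 : ∀ s →
      singleRuns 2 s + #110 (true ∷ true ∷ s) + ends11 (true ∷ true ∷ s)
      ≡ #10 (true ∷ true ∷ s) + ends1 (true ∷ true ∷ s)
    singleRuns+longRuns-2 []          = refl
    singleRuns+longRuns-2 (false ∷ s) =
      trans (cong (_+ ends11 s) (+-suc (singleRuns 0 s) (#110 s))) (cong suc (singleRuns+longRuns s))
    singleRuns+longRuns-2 (true ∷ s)  =
      trans (cong (λ z → z + #110 (true ∷ true ∷ s) + ends11 (true ∷ true ∷ s)) (singleRuns-suc 1 s))
            (singleRuns+longRuns-2 s)

  numRuns≡ : ∀ {n} (v : Vec Bool n) → numRuns v ≡ #10 (toList v) + ends1 (toList v)
  numRuns≡ v = length-runsFrom (toList v)

  numRuns1+longRuns : ∀ {n} (v : Vec Bool n) → numRuns1 v + (#110 (toList v) + ends11 (toList v)) ≡ numRuns v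
  numRuns1+longRuns v =
    trans (sym (+-assoc (numRuns1 v) _ _)) (trans (singleRuns+longRuns (toList v)) (sym (numRuns≡ v)))

  weight≡numRuns+#11 : ∀ {n} (v : Vec Bool n) → weight v ≡ numRuns v + #11 (toList v)
  weight≡numRuns+#11 v = begin
    weight v                    ≡⟨ weight≡occurrences v ⟩
    occurrences (true ∷ []) s   ≡⟨ occurrences-split (true ∷ []) s ⟩
    #10 s + #11 s + ends1 s     ≡⟨ swap (#10 s) (#11 s) (ends1 s) ⟩
    #10 s + ends1 s + #11 s     ≡⟨ cong (_+ #11 s) (sym (numRuns≡ v)) ⟩
    numRuns v + #11 s           ∎
    where
    open ≡-Reasoning
    s : List Bool
    s = toList v
    swap : ∀ a b c → a + b + c ≡ a + c + b
    swap = solve-∀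

open Runs

module FlipSets where

  open import Data.Nat using (_+_; _*_; _≡ᵇ_; _≤_; z≤n; s≤s)
  open import Data.Nat.Properties using (+-comm; +-identityʳ; *-zeroʳ)
  open import Data.Nat.Combinatorics using (nC1≡n; nCk+nC[k+1]≡[n+1]C[k+1])
  open import Data.Nat.Tactic.RingSolver using (solve-∀)

  -- flipSets f r j k s counts the sets D of pairwise non-adjacent positions i with s_i = 1, |D| ≤ r,
  -- and not containing the first position if f, such that j + ω(s') ≡ k + ω(s), where s' is s with
  -- s_i set to 0 and s_{i+1} complemented for every i ∈ D. The flag f records that the position just
  -- before s lies in D; the counters j and k accumulate the weights of s' and s.
  flipSets : Bool → ℕ → ℕ → ℕ → List Bool → ℕ
  flipSets f     r       j k []          = bit (j ≡ᵇ k)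
  flipSets f     r       j k (false ∷ s) = flipSets false r (bit f + j) k s
  flipSets true  r       j k (true ∷ s)  = flipSets false r j (suc k) s
  flipSets false zero    j k (true ∷ s)  = flipSets false zero (suc j) (suc k) s
  flipSets false (suc r) j k (true ∷ s)  =
    flipSets false (suc r) (suc j) (suc k) s + flipSets true r j (suc k) s

  flipSets-suc-suc : ∀ f r j k s → flipSets f r (suc j) (suc k) s ≡ flipSets f r j k s
  flipSets-suc-suc f     r       j k []          = refl
  flipSets-suc-suc false r       j k (false ∷ s) = flipSets-suc-suc false r j k s
  flipSets-suc-suc true  r       j k (false ∷ s) = flipSets-suc-suc false r (suc j) k s
  flipSets-suc-suc true  r       j k (true ∷ s)  = flipSets-suc-suc false r j (suc k) s
  flipSets-suc-suc false zero    j k (true ∷ s)  = flipSets-suc-suc false zero (suc j) (suc k) s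
  flipSets-suc-suc false (suc r) j k (true ∷ s)  =
    cong₂ _+_ (flipSets-suc-suc false (suc r) (suc j) (suc k) s) (flipSets-suc-suc true r j (suc k) s)

  mutual
    flipSets-increase : ∀ r d s → flipSets false r 0 (suc d) s ≡ 0
    flipSets-increase r       d []          = refl
    flipSets-increase r       d (false ∷ s) = flipSets-increase r d s
    flipSets-increase zero    d (true ∷ s)  =
      trans (flipSets-suc-suc false zero 0 (suc d) s) (flipSets-increase zero d s)
    flipSets-increase (suc r) d (true ∷ s)  =
      cong₂ _+_ (trans (flipSets-suc-suc false (suc r) 0 (suc d) s) (flipSets-increase (suc r) d s))
                (flipSets-increase-after-flip r d s)

    -- right after a change, j may still gain the 1 that the change added to k
    flipSets-increase-after-flip : ∀ r d s → flipSets true r 0 (suc (suc d)) s ≡ 0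
    flipSets-increase-after-flip r d []          = refl
    flipSets-increase-after-flip r d (false ∷ s) =
      trans (flipSets-suc-suc false r 0 (suc d) s) (flipSets-increase r d s)
    flipSets-increase-after-flip r d (true ∷ s)  = flipSets-increase r (suc (suc d)) s

  flipSets-zero : ∀ j k s → flipSets false zero j k s ≡ bit (j ≡ᵇ k)
  flipSets-zero j k []          = refl
  flipSets-zero j k (false ∷ s) = flipSets-zero j k s
  flipSets-zero j k (true ∷ s)  = trans (flipSets-suc-suc false zero j k s) (flipSets-zero j k s)

  dropCount : ℕ → ℕ → List Bool → ℕ
  dropCount r j = flipSets false r j 0

  dropCount-10 : ∀ r j s → dropCount (suc r) j (true ∷ false ∷ s) ≡ dropCount (suc r) j s + dropCount r j s
  dropCount-10 r j s = cong₂ _+_ (flipSets-suc-suc false (suc r) j 0 s) (flipSets-suc-suc false r j 0 s)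

  dropCount-11 : ∀ r j s →
    dropCount (suc r) (2 + j) (true ∷ true ∷ s) ≡ dropCount (suc r) (2 + j) (true ∷ s) + dropCount r j s
  dropCount-11 r j s = cong₂ _+_ (flipSets-suc-suc false (suc r) (2 + j) 0 (true ∷ s))
    (trans (flipSets-suc-suc false r (suc j) 1 s) (flipSets-suc-suc false r j 0 s))

  dropCount-11-0 : ∀ r s → dropCount (suc r) 0 (true ∷ true ∷ s) ≡ dropCount (suc r) 0 (true ∷ s)
  dropCount-11-0 r s =
    trans (cong₂ _+_ (flipSets-suc-suc false (suc r) 0 0 (true ∷ s)) (flipSets-increase r 1 s)) (+-identityʳ _)

  dropCount-11-1 : ∀ r s → dropCount (suc r) 1 (true ∷ true ∷ s) ≡ dropCount (suc r) 1 (true ∷ s)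
  dropCount-11-1 r s = trans (cong₂ _+_ (flipSets-suc-suc false (suc r) 1 0 (true ∷ s))
    (trans (flipSets-suc-suc false r 0 1 s) (flipSets-increase r 0 s))) (+-identityʳ _)

  dropCount-1-0 : ∀ s → dropCount 1 0 s ≡ suc (#10 s)
  dropCount-1-0 []                 = refl
  dropCount-1-0 (false ∷ s)        = dropCount-1-0 s
  dropCount-1-0 (true ∷ [])        = refl
  dropCount-1-0 (true ∷ false ∷ s) = trans (dropCount-10 0 0 s)
    (trans (cong₂ _+_ (dropCount-1-0 s) (flipSets-zero 0 0 s)) (+-comm (suc (#10 s)) 1))
  dropCount-1-0 (true ∷ true ∷ s)  = trans (dropCount-11-0 0 s) (dropCount-1-0 (true ∷ s))

  dropCount-1-1 : ∀ s → dropCount 1 1 s ≡ ends1 s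
  dropCount-1-1 []                 = refl
  dropCount-1-1 (false ∷ s)        = dropCount-1-1 s
  dropCount-1-1 (true ∷ [])        = refl
  dropCount-1-1 (true ∷ false ∷ s) = trans (dropCount-10 0 1 s)
    (trans (cong₂ _+_ (dropCount-1-1 s) (flipSets-zero 1 0 s)) (+-identityʳ _))
  dropCount-1-1 (true ∷ true ∷ s)  = trans (dropCount-11-1 0 s) (dropCount-1-1 (true ∷ s))

  dropCount-1-2 : ∀ s → dropCount 1 2 s ≡ #11 s
  dropCount-1-2 []                 = refl
  dropCount-1-2 (false ∷ s)        = dropCount-1-2 s
  dropCount-1-2 (true ∷ [])        = refl
  dropCount-1-2 (true ∷ false ∷ s) = trans (dropCount-10 0 2 s)
    (trans (cong₂ _+_ (dropCount-1-2 s) (flipSets-zero 2 0 s)) (+-identityʳ _))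
  dropCount-1-2 (true ∷ true ∷ s)  = trans (dropCount-11 0 0 s)
    (trans (cong₂ _+_ (dropCount-1-2 (true ∷ s)) (flipSets-zero 0 0 s)) (+-comm (#11 (true ∷ s)) 1))

  dropCount-1-≥3 : ∀ ℓ s → dropCount 1 (3 + ℓ) s ≡ 0
  dropCount-1-≥3 ℓ []                 = refl
  dropCount-1-≥3 ℓ (false ∷ s)        = dropCount-1-≥3 ℓ s
  dropCount-1-≥3 ℓ (true ∷ [])        = refl
  dropCount-1-≥3 ℓ (true ∷ false ∷ s) =
    trans (dropCount-10 0 (3 + ℓ) s) (cong₂ _+_ (dropCount-1-≥3 ℓ s) (flipSets-zero (3 + ℓ) 0 s))
  dropCount-1-≥3 ℓ (true ∷ true ∷ s)  =
    trans (dropCount-11 0 (suc ℓ) s) (cong₂ _+_ (dropCount-1-≥3 ℓ (true ∷ s)) (flipSets-zero (suc ℓ) 0 s))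

  suc-C-2 : ∀ c → suc c C 2 ≡ c C 2 + c
  suc-C-2 c = begin
    suc c C 2       ≡⟨ sym (nCk+nC[k+1]≡[n+1]C[k+1] c 1) ⟩
    c C 1 + c C 2   ≡⟨ cong (_+ c C 2) (nC1≡n c) ⟩
    c + c C 2       ≡⟨ +-comm c (c C 2) ⟩
    c C 2 + c       ∎
    where open ≡-Reasoning

  add-with-correction : ∀ x p b e {a} → x + p ≡ a → (x + b) + (e + p) ≡ a + b + e
  add-with-correction x p b e refl = reorder x p b e
    where
    reorder : ∀ x p b e → (x + b) + (e + p) ≡ x + p + b + e
    reorder = solve-∀

  dropCount-2-0 : ∀ s → dropCount 2 0 s ≡ suc (#10 s + #10 s C 2)
  dropCount-2-0 []                 = refl
  dropCount-2-0 (false ∷ s)        = dropCount-2-0 s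
  dropCount-2-0 (true ∷ [])        = refl
  dropCount-2-0 (true ∷ false ∷ s) = begin
    dropCount 2 0 (true ∷ false ∷ s)   ≡⟨ dropCount-10 1 0 s ⟩
    dropCount 2 0 s + dropCount 1 0 s  ≡⟨ cong₂ _+_ (dropCount-2-0 s) (dropCount-1-0 s) ⟩
    suc (c + c C 2) + suc c            ≡⟨ arith c (c C 2) ⟩
    suc (suc c + (c C 2 + c))          ≡⟨ cong (λ z → suc (suc c + z)) (sym (suc-C-2 c)) ⟩
    suc (suc c + suc c C 2)            ∎
    where
    open ≡-Reasoning
    c : ℕ
    c = #10 s
    arith : ∀ c x → suc (c + x) + suc c ≡ suc (suc c + (x + c))
    arith = solve-∀
  dropCount-2-0 (true ∷ true ∷ s)  = trans (dropCount-11-0 1 s) (dropCount-2-0 (true ∷ s))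

  dropCount-2-1 : ∀ s → dropCount 2 1 s ≡ ends1 s + #10 s * ends1 s
  dropCount-2-1 []                 = refl
  dropCount-2-1 (false ∷ s)        = dropCount-2-1 s
  dropCount-2-1 (true ∷ [])        = refl
  dropCount-2-1 (true ∷ false ∷ s) = trans (dropCount-10 1 1 s)
    (trans (cong₂ _+_ (dropCount-2-1 s) (dropCount-1-1 s)) (arith (#10 s) (ends1 s)))
    where
    arith : ∀ c e → (e + c * e) + e ≡ e + suc c * e
    arith = solve-∀
  dropCount-2-1 (true ∷ true ∷ s)  = trans (dropCount-11-1 1 s) (dropCount-2-1 (true ∷ s))

  -- The products on the right also count pairs of adjacent positions, which cannot both lie in D;
  -- the added terms count exactly those pairs.
  dropCount-2-2 : ∀ s → dropCount 2 2 s + #110 s ≡ #11 s + #11 s * #10 s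
  dropCount-2-2 []                        = refl
  dropCount-2-2 (false ∷ s)               = dropCount-2-2 s
  dropCount-2-2 (true ∷ [])               = refl
  dropCount-2-2 (true ∷ false ∷ s)        =
    trans (cong (_+ #110 s) (trans (dropCount-10 1 2 s) (cong (X +_) (dropCount-1-2 s))))
          (trans (add-with-correction X (#110 s) (#11 s) 0 (dropCount-2-2 s)) (arith (#11 s) (#10 s)))
    where
    X : ℕ
    X = dropCount 2 2 s
    arith : ∀ t c → t + t * c + t + 0 ≡ t + t * suc c
    arith = solve-∀
  dropCount-2-2 (true ∷ true ∷ [])        = refl
  dropCount-2-2 (true ∷ true ∷ false ∷ s) =
    trans (cong (_+ suc (#110 s)) (trans (dropCount-11 1 0 (false ∷ s)) (cong (X +_) (dropCount-1-0 s))))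
          (trans (add-with-correction X (#110 s) (suc (#10 s)) 1 (dropCount-2-2 (true ∷ false ∷ s)))
                 (arith (#11 s) (#10 s)))
    where
    X : ℕ
    X = dropCount 2 2 (true ∷ false ∷ s)
    arith : ∀ t c → t + t * suc c + suc c + 1 ≡ suc t + suc t * suc c
    arith = solve-∀
  dropCount-2-2 (true ∷ true ∷ true ∷ s)  =
    trans (cong (_+ p) (trans (dropCount-11 1 0 (true ∷ s)) (cong (X +_) (dropCount-1-0 (true ∷ s)))))
          (trans (add-with-correction X p (suc (#10 (true ∷ s))) 0 (dropCount-2-2 (true ∷ true ∷ s)))
                 (arith (#11 (true ∷ true ∷ s)) (#10 (true ∷ s))))
    where
    X : ℕ
    X = dropCount 2 2 (true ∷ true ∷ s)
    p : ℕ
    p = #110 (true ∷ true ∷ s)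
    arith : ∀ t c → t + t * c + suc c + 0 ≡ suc t + suc t * c
    arith = solve-∀

  dropCount-2-3 : ∀ s → dropCount 2 3 s + ends11 s ≡ #11 s * ends1 s
  dropCount-2-3 []                        = refl
  dropCount-2-3 (false ∷ s)               = dropCount-2-3 s
  dropCount-2-3 (true ∷ [])               = refl
  dropCount-2-3 (true ∷ false ∷ s)        =
    trans (cong (_+ ends11 s) (trans (dropCount-10 1 3 s) (cong (X +_) (dropCount-1-≥3 0 s))))
          (trans (add-with-correction X (ends11 s) 0 0 (dropCount-2-3 s)) (arith (#11 s * ends1 s)))
    where
    X : ℕ
    X = dropCount 2 3 s
    arith : ∀ a → a + 0 + 0 ≡ a
    arith = solve-∀
  dropCount-2-3 (true ∷ true ∷ [])        = refl
  dropCount-2-3 (true ∷ true ∷ false ∷ s) =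
    trans (cong (_+ ends11 s) (trans (dropCount-11 1 1 (false ∷ s)) (cong (X +_) (dropCount-1-1 s))))
          (trans (add-with-correction X (ends11 s) (ends1 s) 0 (dropCount-2-3 (true ∷ false ∷ s)))
                 (arith (#11 s) (ends1 s)))
    where
    X : ℕ
    X = dropCount 2 3 (true ∷ false ∷ s)
    arith : ∀ t e → t * e + e + 0 ≡ suc t * e
    arith = solve-∀
  dropCount-2-3 (true ∷ true ∷ true ∷ s)  =
    trans (cong (_+ p) (trans (dropCount-11 1 1 (true ∷ s)) (cong (X +_) (dropCount-1-1 (true ∷ s)))))
          (trans (add-with-correction X p (ends1 (true ∷ s)) 0 (dropCount-2-3 (true ∷ true ∷ s)))
                 (arith (#11 (true ∷ true ∷ s)) (ends1 (true ∷ s))))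
    where
    X : ℕ
    X = dropCount 2 3 (true ∷ true ∷ s)
    p : ℕ
    p = ends11 (true ∷ true ∷ s)
    arith : ∀ t e → t * e + e + 0 ≡ suc t * e
    arith = solve-∀

  dropCount-2-4 : ∀ s → dropCount 2 4 s + #111 s ≡ #11 s C 2
  dropCount-2-4 []                        = refl
  dropCount-2-4 (false ∷ s)               = dropCount-2-4 s
  dropCount-2-4 (true ∷ [])               = refl
  dropCount-2-4 (true ∷ false ∷ s)        =
    trans (cong (_+ #111 s) (trans (dropCount-10 1 4 s) (cong (X +_) (dropCount-1-≥3 1 s))))
          (trans (add-with-correction X (#111 s) 0 0 (dropCount-2-4 s)) (arith (#11 s C 2)))
    where
    X : ℕ
    X = dropCount 2 4 s
    arith : ∀ a → a + 0 + 0 ≡ a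
    arith = solve-∀
  dropCount-2-4 (true ∷ true ∷ [])        = refl
  dropCount-2-4 (true ∷ true ∷ false ∷ s) =
    trans (cong (_+ #111 s) (trans (dropCount-11 1 2 (false ∷ s)) (cong (X +_) (dropCount-1-2 s))))
          (trans (add-with-correction X (#111 s) (#11 s) 0 (dropCount-2-4 (true ∷ false ∷ s)))
                 (trans (+-identityʳ _) (sym (suc-C-2 (#11 s)))))
    where
    X : ℕ
    X = dropCount 2 4 (true ∷ false ∷ s)
  dropCount-2-4 (true ∷ true ∷ true ∷ s)  =
    trans (cong (_+ suc p) (trans (dropCount-11 1 2 (true ∷ s)) (cong (X +_) (dropCount-1-2 (true ∷ s)))))
          (trans (add-with-correction X p u 1 (dropCount-2-4 (true ∷ true ∷ s)))
                 (trans (arith (suc u C 2) u) (sym (suc-C-2 (suc u)))))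
    where
    X : ℕ
    X = dropCount 2 4 (true ∷ true ∷ s)
    p : ℕ
    p = #111 (true ∷ true ∷ s)
    u : ℕ
    u = #11 (true ∷ s)
    arith : ∀ a u → a + u + 1 ≡ a + suc u
    arith = solve-∀

  dropCount-2-0+1 : ∀ s → dropCount 2 0 s + dropCount 2 1 s ≡ 1 + (#10 s + ends1 s) + (#10 s + ends1 s) C 2
  dropCount-2-0+1 s = trans (cong₂ _+_ (dropCount-2-0 s) (dropCount-2-1 s)) (add-bit (#10 s) (ends1 s) (ends1≤1 s))
    where
    add-bit : ∀ c e → e ≤ 1 → suc (c + c C 2) + (e + c * e) ≡ 1 + (c + e) + (c + e) C 2
    add-bit c .0 z≤n       rewrite +-identityʳ c | *-zeroʳ c = +-identityʳ _
    add-bit c .1 (s≤s z≤n) rewrite +-comm c 1 | suc-C-2 c = arith c (c C 2)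
      where
      arith : ∀ c x → suc (c + x) + (1 + c * 1) ≡ 1 + suc c + (x + c)
      arith = solve-∀

open FlipSets

module Reduction where

  open import Data.Bool using () renaming (_≟_ to _≟ᵇ_)
  open import Data.Bool.Properties using (T-∧; T-≡; ⇔→≡; xor-same)
  open import Data.Nat using (_+_; _≤_; z≤n; s≤s; _≡ᵇ_; _<ᵇ_; pred)
  open import Data.Nat.Properties using (+-suc; +-comm; +-identityʳ; m≤n⇒m≤1+n; ≤ᵇ⇒≤; ≤⇒≤ᵇ)
  open import Data.List.Properties using (filter-++; length-++)
  open import Data.List.Membership.Propositional using (_∈_; lose)
  open import Data.List.Membership.Propositional.Properties using (∈-++⁺ˡ; ∈-++⁺ʳ; ∈-map⁺)
  open import Data.List.Relation.Unary.Any using (here; satisfied)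
  open import Data.List.Relation.Unary.Any.Properties using (any⁺; any⁻)
  open import Data.Vec.Properties using (≡-dec)
  open import Data.Unit using (tt)
  open import Function using (_∘_; mk⇔; Equivalence)
  open import Relation.Nullary.Decidable using (toWitness; fromWitness)

  count : {X : Set} → (X → Bool) → List X → ℕ
  count P xs = length (filter (λ x → P x ≟ᵇ true) xs)

  count-++ : {X : Set} (P : X → Bool) (xs ys : List X) → count P (xs ++ ys) ≡ count P xs + count P ys
  count-++ P xs ys = trans (cong length (filter-++ (λ x → P x ≟ᵇ true) xs ys)) (length-++ (filter _ xs))

  count-map : {X Y : Set} (P : Y → Bool) (f : X → Y) (xs : List X) → count P (map f xs) ≡ count (P ∘ f) xs
  count-map P f []       = refl
  count-map P f (x ∷ xs) with P (f x)
  ... | true  = cong suc (count-map P f xs)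
  ... | false = count-map P f xs

  count-cong : {X : Set} {P Q : X → Bool} (xs : List X) → (∀ x → P x ≡ Q x) → count P xs ≡ count Q xs
  count-cong                 []       P≗Q = refl
  count-cong {P = P} {Q = Q} (x ∷ xs) P≗Q with P x | Q x | P≗Q x
  ... | true  | .true  | refl = cong suc (count-cong xs P≗Q)
  ... | false | .false | refl = count-cong xs P≗Q

  count-false : {X : Set} (xs : List X) → count (λ _ → false) xs ≡ 0
  count-false []       = refl
  count-false (x ∷ xs) = count-false xs

  count-allVecs-suc : ∀ n (P : Vec Bool (suc n) → Bool) →
    count P (allVecs (suc n)) ≡ count (P ∘ (false ∷_)) (allVecs n) + count (P ∘ (true ∷_)) (allVecs n)
  count-allVecs-suc n P = trans (count-++ P (map (false ∷_) (allVecs n)) (map (true ∷_) (allVecs n)))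
    (cong₂ _+_ (count-map P (false ∷_) (allVecs n)) (count-map P (true ∷_) (allVecs n)))

  ∈-allVecs : ∀ n (v : Vec Bool n) → v ∈ allVecs n
  ∈-allVecs zero    []          = here refl
  ∈-allVecs (suc n) (false ∷ v) = ∈-++⁺ˡ (∈-map⁺ (false ∷_) (∈-allVecs n v))
  ∈-allVecs (suc n) (true ∷ v)  =
    ∈-++⁺ʳ (map (false ∷_) (allVecs n)) (∈-map⁺ (true ∷_) (∈-allVecs n v))

  ==ᵥ⇒≡ : ∀ {n} (x y : Vec Bool n) → T (x ==ᵥ y) → x ≡ y
  ==ᵥ⇒≡ x y = toWitness {a? = ≡-dec _≟ᵇ_ x y}

  ==ᵥ-refl : ∀ {n} (x : Vec Bool n) → T (x ==ᵥ x)
  ==ᵥ-refl x = fromWitness {a? = ≡-dec _≟ᵇ_ x x} refl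

  not-∧-false : ∀ b → T (not (b ∧ false))
  not-∧-false false = tt
  not-∧-false true  = tt

  not-xor-self : ∀ b → T (not (b xor b))
  not-xor-self false = tt
  not-xor-self true  = tt

  -- reachable px py r xs ys: ys = φ_E(xs) for a grain pattern E changing at most r symbols, where px
  -- and py are the symbols just before xs and ys. A symbol can only change into its predecessor, and
  -- not directly after a changed symbol.
  reachable : ∀ {n} → Bool → Bool → ℕ → Vec Bool n → Vec Bool n → Bool
  reachable px py r []       []       = true
  reachable px py r (a ∷ xs) (b ∷ ys) =
    if a xor b
    then (not (px xor py) ∧ (px xor a) ∧ (0 <ᵇ r)) ∧ reachable a b (pred r) xs ys
    else reachable a b r xs ys

  reachable-phiFrom : ∀ {n} px py pe (es xs : Vec Bool n) r → (pe ≡ false → py ≡ px) →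
    T (noAdj (pe ∷ es)) → weight es ≤ r → T (reachable px py r xs (phiFrom px es xs))
  reachable-phiFrom px py pe    []           []           r       py≡px noAdj-es w = tt
  reachable-phiFrom px py pe    (false ∷ es) (false ∷ xs) r       py≡px noAdj-es w =
    reachable-phiFrom false false false es xs r (λ _ → refl) (proj₂ (Equivalence.to T-∧ noAdj-es)) w
  reachable-phiFrom px py pe    (false ∷ es) (true ∷ xs)  r       py≡px noAdj-es w =
    reachable-phiFrom true true false es xs r (λ _ → refl) (proj₂ (Equivalence.to T-∧ noAdj-es)) w
  reachable-phiFrom px py true  (true ∷ es)  xs           r       py≡px ()       w
  reachable-phiFrom px py false (true ∷ es)  (a ∷ xs)     zero    py≡px noAdj-es ()
  reachable-phiFrom px py false (true ∷ es)  (a ∷ xs)     (suc r) py≡px noAdj-es (s≤s w) with py≡px refl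
  ... | refl with px | a
  ... | false | false = reachable-phiFrom false false true es xs (suc r) (λ ()) noAdj-es (m≤n⇒m≤1+n w)
  ... | false | true  = reachable-phiFrom true  false true es xs r       (λ ()) noAdj-es w
  ... | true  | false = reachable-phiFrom false true  true es xs r       (λ ()) noAdj-es w
  ... | true  | true  = reachable-phiFrom true  true  true es xs (suc r) (λ ()) noAdj-es (m≤n⇒m≤1+n w)

  reachable-complete : ∀ {n} px py r (xs ys : Vec Bool n) → T (reachable px py r xs ys) →
    phiFrom px (zipWith _xor_ xs ys) xs ≡ ys
    × T (noAdj ((px xor py) ∷ zipWith _xor_ xs ys))
    × weight (zipWith _xor_ xs ys) ≤ r
  reachable-complete px py r [] [] h = refl , tt , z≤n
  reachable-complete px py r (false ∷ xs) (false ∷ ys) h with reachable-complete false false r xs ys h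
  ... | phi≡ys , noAdj-es , w =
    cong (false ∷_) phi≡ys , Equivalence.from T-∧ (not-∧-false (px xor py) , noAdj-es) , w
  reachable-complete px py r (true ∷ xs) (true ∷ ys) h with reachable-complete true true r xs ys h
  ... | phi≡ys , noAdj-es , w =
    cong (true ∷_) phi≡ys , Equivalence.from T-∧ (not-∧-false (px xor py) , noAdj-es) , w
  reachable-complete true true (suc r) (false ∷ xs) (true ∷ ys) h with reachable-complete false true r xs ys h
  ... | phi≡ys , noAdj-es , w = cong (true ∷_) phi≡ys , noAdj-es , s≤s w
  reachable-complete false false (suc r) (true ∷ xs) (false ∷ ys) h with reachable-complete true false r xs ys h
  ... | phi≡ys , noAdj-es , w = cong (false ∷_) phi≡ys , noAdj-es , s≤s w
  reachable-complete false false r    (false ∷ xs) (true ∷ ys)  ()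
  reachable-complete false true  r    (false ∷ xs) (true ∷ ys)  ()
  reachable-complete true  false r    (false ∷ xs) (true ∷ ys)  ()
  reachable-complete true  true  zero (false ∷ xs) (true ∷ ys)  ()
  reachable-complete true  true  r    (true ∷ xs)  (false ∷ ys) ()
  reachable-complete false true  r    (true ∷ xs)  (false ∷ ys) ()
  reachable-complete true  false r    (true ∷ xs)  (false ∷ ys) ()
  reachable-complete false false zero (true ∷ xs)  (false ∷ ys) ()

  inPhi-sound : ∀ {n} a (xs : Vec Bool n) b ys →
    T (inPhi 2 (a ∷ xs) (b ∷ ys)) → T (not (a xor b) ∧ reachable a a 2 xs ys)
  inPhi-sound {n} a xs b ys h
    with satisfied (any⁻ (λ E → inGrainSet 2 E ∧ (phi E (a ∷ xs) ==ᵥ (b ∷ ys))) (allVecs (suc n)) h)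
  ... | false ∷ es , hE with Equivalence.to T-∧ hE
  ... | grain , phi≡y with Equivalence.to T-∧ grain | ==ᵥ⇒≡ (a ∷ phiFrom a es xs) (b ∷ ys) phi≡y
  ... | noAdj-es , w | refl = Equivalence.from T-∧
    (not-xor-self a , reachable-phiFrom a a false es xs 2 (λ _ → refl) noAdj-es (≤ᵇ⇒≤ (weight es) 2 w))

  inPhi-of-reachable : ∀ {n} a (xs ys : Vec Bool n) →
    T (reachable a a 2 xs ys) → T (inPhi 2 (a ∷ xs) (a ∷ ys))
  inPhi-of-reachable {n} a xs ys h with reachable-complete a a 2 xs ys h
  ... | phi≡ys , noAdj-es , w =
    any⁺ (λ E → inGrainSet 2 E ∧ (phi E (a ∷ xs) ==ᵥ (a ∷ ys)))
      (lose (∈-allVecs (suc n) (false ∷ es)) (Equivalence.from T-∧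
        ( Equivalence.from T-∧ (subst (λ c → T (noAdj (c ∷ es))) (xor-same a) noAdj-es , ≤⇒≤ᵇ w)
        , subst (λ z → T ((a ∷ phiFrom a es xs) ==ᵥ (a ∷ z))) phi≡ys (==ᵥ-refl _))))
    where
    es : Vec Bool n
    es = zipWith _xor_ xs ys

  inPhi-complete : ∀ {n} a (xs : Vec Bool n) b ys →
    T (not (a xor b) ∧ reachable a a 2 xs ys) → T (inPhi 2 (a ∷ xs) (b ∷ ys))
  inPhi-complete false xs false ys h = inPhi-of-reachable false xs ys h
  inPhi-complete true  xs true  ys h = inPhi-of-reachable true xs ys h

  inPhi-∷ : ∀ {n} a (xs : Vec Bool n) b ys →
    inPhi 2 (a ∷ xs) (b ∷ ys) ≡ not (a xor b) ∧ reachable a a 2 xs ys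
  inPhi-∷ a xs b ys = ⇔→≡ {z = true} (mk⇔
    (Equivalence.to T-≡ ∘ inPhi-sound a xs b ys ∘ Equivalence.from T-≡)
    (Equivalence.to T-≡ ∘ inPhi-complete a xs b ys ∘ Equivalence.from T-≡))

  balanced : ∀ {n} → Bool → Bool → ℕ → ℕ → ℕ → Vec Bool n → Vec Bool n → Bool
  balanced px py r j k xs ys =
    reachable px py r xs ys ∧ (weight (deriv (py ∷ ys)) + j ≡ᵇ weight (deriv (px ∷ xs)) + k)

  balanced-tail : ∀ {n} → Bool → Bool → ℕ → ℕ → ℕ → Bool → Vec Bool n → Bool → Vec Bool n → Bool
  balanced-tail px py r j k a xs b ys = reachable px py r (a ∷ xs) (b ∷ ys)
    ∧ (weight (deriv (b ∷ ys)) + (bit (py xor b) + j) ≡ᵇ weight (deriv (a ∷ xs)) + (bit (px xor a) + k))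

  weight-∷-+ : ∀ c {n} (v : Vec Bool n) j → weight (c ∷ v) + j ≡ weight v + (bit c + j)
  weight-∷-+ true  v j = sym (+-suc (weight v) j)
  weight-∷-+ false v j = refl

  balanced-∷ : ∀ {n} px py r j k a (xs : Vec Bool n) b ys →
    balanced px py r j k (a ∷ xs) (b ∷ ys) ≡ balanced-tail px py r j k a xs b ys
  balanced-∷ px py r j k a xs b ys = cong₂ (λ u w → reachable px py r (a ∷ xs) (b ∷ ys) ∧ (u ≡ᵇ w))
    (weight-∷-+ (py xor b) (deriv (b ∷ ys)) j) (weight-∷-+ (px xor a) (deriv (a ∷ xs)) k)

  CountsBalanced : ∀ {n} → Vec Bool n → Set
  CountsBalanced {n} xs = ∀ px py r j k →
    count (balanced px py r j k xs) (allVecs n) ≡ flipSets (px xor py) r j k (toList (deriv (px ∷ xs)))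

  -- Of the two possible first symbols of ys at most one is reachable, unless the first symbol of xs
  -- may be changed.
  count-balanced-tail : ∀ {n} (xs : Vec Bool n) → CountsBalanced xs → ∀ px py a r j k →
    count (balanced-tail px py r j k a xs false) (allVecs n) + count (balanced-tail px py r j k a xs true) (allVecs n)
    ≡ flipSets (px xor py) r j k ((px xor a) ∷ toList (deriv (a ∷ xs)))
  count-balanced-tail {n} xs IH false false false r j k =
    trans (cong₂ _+_ (IH false false r j k) (count-false (allVecs n))) (+-identityʳ _)
  count-balanced-tail {n} xs IH false false true zero j k =
    cong₂ _+_ (count-false (allVecs n)) (IH true true zero (suc j) (suc k))
  count-balanced-tail {n} xs IH false false true (suc r) j k =
    trans (cong₂ _+_ (IH true false r j (suc k)) (IH true true (suc r) (suc j) (suc k)))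
          (+-comm (flipSets true r j (suc k) s) (flipSets false (suc r) (suc j) (suc k) s))
    where
    s : List Bool
    s = toList (deriv (true ∷ xs))
  count-balanced-tail {n} xs IH false true false r j k =
    trans (cong₂ _+_ (IH false false r (suc j) k) (count-false (allVecs n))) (+-identityʳ _)
  count-balanced-tail {n} xs IH false true true r j k =
    cong₂ _+_ (count-false (allVecs n)) (IH true true r j (suc k))
  count-balanced-tail {n} xs IH true false false r j k =
    trans (cong₂ _+_ (IH false false r j (suc k)) (count-false (allVecs n))) (+-identityʳ _)
  count-balanced-tail {n} xs IH true false true r j k =
    cong₂ _+_ (count-false (allVecs n)) (IH true true r (suc j) k)
  count-balanced-tail {n} xs IH true true false zero j k =
    trans (cong₂ _+_ (IH false false zero (suc j) (suc k)) (count-false (allVecs n))) (+-identityʳ _)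
  count-balanced-tail {n} xs IH true true false (suc r) j k =
    cong₂ _+_ (IH false false (suc r) (suc j) (suc k)) (IH false true r j (suc k))
  count-balanced-tail {n} xs IH true true true r j k =
    cong₂ _+_ (count-false (allVecs n)) (IH true true r j k)

  count-balanced : ∀ {n} (xs : Vec Bool n) → CountsBalanced xs
  count-balanced [] px py r j k with j ≡ᵇ k
  ... | true  = refl
  ... | false = refl
  count-balanced {suc n} (a ∷ xs) px py r j k = begin
    count (balanced px py r j k (a ∷ xs)) (allVecs (suc n))
      ≡⟨ count-allVecs-suc n (balanced px py r j k (a ∷ xs)) ⟩
    count (balanced px py r j k (a ∷ xs) ∘ (false ∷_)) (allVecs n)
      + count (balanced px py r j k (a ∷ xs) ∘ (true ∷_)) (allVecs n)
      ≡⟨ cong₂ _+_ (count-cong (allVecs n) (balanced-∷ px py r j k a xs false))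
                   (count-cong (allVecs n) (balanced-∷ px py r j k a xs true)) ⟩
    count (balanced-tail px py r j k a xs false) (allVecs n)
      + count (balanced-tail px py r j k a xs true) (allVecs n)
      ≡⟨ count-balanced-tail xs (count-balanced xs) px py a r j k ⟩
    flipSets (px xor py) r j k (toList (deriv (px ∷ a ∷ xs))) ∎
    where open ≡-Reasoning

  count-inPhi : ∀ {n} j a (xs : Vec Bool n) b → count (λ ys → inPhi 2 (a ∷ xs) (b ∷ ys)
      ∧ (weight (deriv (b ∷ ys)) + j ≡ᵇ weight (deriv (a ∷ xs)))) (allVecs n)
    ≡ count (λ ys → (not (a xor b) ∧ reachable a a 2 xs ys)
      ∧ (weight (deriv (b ∷ ys)) + j ≡ᵇ weight (deriv (a ∷ xs)) + 0)) (allVecs n)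
  count-inPhi {n} j a xs b = count-cong (allVecs n) λ ys →
    cong₂ _∧_ (inPhi-∷ a xs b ys) (cong (weight (deriv (b ∷ ys)) + j ≡ᵇ_) (sym (+-identityʳ _)))

  A≡dropCount : ∀ {n} j (x : Vec Bool (suc n)) → A j x ≡ dropCount 2 j (toList (deriv x))
  A≡dropCount {n} j (a ∷ xs) =
    trans (count-allVecs-suc n _)
          (trans (cong₂ _+_ (count-inPhi j a xs false) (count-inPhi j a xs true)) (by-first-symbol a))
    where
    by-first-symbol : ∀ a → count (λ ys → (not (a xor false) ∧ reachable a a 2 xs ys)
        ∧ (weight (deriv (false ∷ ys)) + j ≡ᵇ weight (deriv (a ∷ xs)) + 0)) (allVecs n)
      + count (λ ys → (not (a xor true) ∧ reachable a a 2 xs ys)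
        ∧ (weight (deriv (true ∷ ys)) + j ≡ᵇ weight (deriv (a ∷ xs)) + 0)) (allVecs n)
      ≡ dropCount 2 j (toList (deriv (a ∷ xs)))
    by-first-symbol false =
      trans (cong₂ _+_ (count-balanced xs false false 2 j 0) (count-false (allVecs n))) (+-identityʳ _)
    by-first-symbol true  = cong₂ _+_ (count-false (allVecs n)) (count-balanced xs true true 2 j 0)

  A-correction : ∀ {n} j (x : Vec Bool (suc n)) {p c} →
    dropCount 2 j (toList (deriv x)) + p ≡ c → A j x + p ≡ c
  A-correction j x {p} = trans (cong (_+ p) (A≡dropCount j x))

open Reduction

open import Data.Nat.Properties using (m+n∸m≡n)
open import Data.Integer using (ℤ; +_; _+_; _-_; _*_)
open import Data.Integer.Properties using (pos-+; pos-*)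
import Data.Integer.Tactic.RingSolver as ℤ-Solver

+-to-difference : ∀ a p {q} → a ℕ.+ p ≡ q → + a ≡ + q - + p
+-to-difference a p refl = trans (identity (+ a) (+ p)) (cong (_- + p) (sym (pos-+ a p)))
  where
  identity : ∀ x y → x ≡ (x + y) - y
  identity = ℤ-Solver.solve-∀

A₂+A₃-formula : ∀ {A₂ A₃ ω m m₁ : ℤ} c₀ c₂ e q₀ q₁ →
  A₂ ≡ (c₂ + c₂ * c₀) - q₀ → A₃ ≡ c₂ * e - q₁ →
  ω ≡ m + c₂ → m ≡ c₀ + e → m₁ ≡ m - (q₀ + q₁) →
  A₂ + A₃ ≡ (ω - m) * (m + + 1) - (m - m₁)
A₂+A₃-formula c₀ c₂ e q₀ q₁ refl refl refl refl refl = identity c₀ c₂ e q₀ q₁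
  where
  identity : ∀ c₀ c₂ e q₀ q₁ → ((c₂ + c₂ * c₀) - q₀) + (c₂ * e - q₁)
    ≡ ((c₀ + e + c₂) - (c₀ + e)) * ((c₀ + e) + + 1) - ((c₀ + e) - ((c₀ + e) - (q₀ + q₁)))
  identity = ℤ-Solver.solve-∀

A₄-formula : ∀ {A₄ ω m m₁ c₂ : ℤ} X q₀ q₁ q₂ →
  A₄ ≡ X - q₂ → c₂ ≡ q₀ + q₂ + q₁ → ω ≡ m + c₂ → m₁ ≡ m - (q₀ + q₁) →
  A₄ ≡ X - (ω - m) + (m - m₁)
A₄-formula {m = m} X q₀ q₁ q₂ refl refl refl refl = identity X m q₀ q₁ q₂
  where
  identity : ∀ X m q₀ q₁ q₂ → X - q₂ ≡ X - ((m + (q₀ + q₂ + q₁)) - m) + (m - (m - (q₀ + q₁)))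
  identity = ℤ-Solver.solve-∀

module _ {n : ℕ} (v : Vec Bool n) where

  private
    s : List Bool
    s = toList v

  weight-ℤ : + weight v ≡ + numRuns v + + #11 s
  weight-ℤ = trans (cong +_ (weight≡numRuns+#11 v)) (pos-+ (numRuns v) (#11 s))

  numRuns-ℤ : + numRuns v ≡ + #10 s + + ends1 s
  numRuns-ℤ = trans (cong +_ (numRuns≡ v)) (pos-+ (#10 s) (ends1 s))

  numRuns1-ℤ : + numRuns1 v ≡ + numRuns v - (+ #110 s + + ends11 s)
  numRuns1-ℤ = trans (+-to-difference (numRuns1 v) _ (numRuns1+longRuns v))
                     (cong (+ numRuns v -_) (pos-+ (#110 s) (ends11 s)))

  #11-ℤ : + #11 s ≡ + #110 s + + #111 s + + ends11 s
  #11-ℤ = trans (cong +_ (occurrences-split (true ∷ true ∷ []) s))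
                (trans (pos-+ (#110 s ℕ.+ #111 s) (ends11 s)) (cong (_+ + ends11 s) (pos-+ (#110 s) (#111 s))))

module _ {n : ℕ} (x : Vec Bool (suc n)) where

  private
    s : List Bool
    s = toList (deriv x)
    m : ℕ
    m = numRuns (deriv x)

  A₀+A₁-ℤ : + A 0 x + + A 1 x ≡ + 1 + + m + + (m C 2)
  A₀+A₁-ℤ = begin
    + A 0 x + + A 1 x
      ≡⟨ sym (pos-+ (A 0 x) (A 1 x)) ⟩
    + (A 0 x ℕ.+ A 1 x)
      ≡⟨ cong +_ (cong₂ ℕ._+_ (A≡dropCount 0 x) (A≡dropCount 1 x)) ⟩
    + (dropCount 2 0 s ℕ.+ dropCount 2 1 s)
      ≡⟨ cong +_ (dropCount-2-0+1 s) ⟩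
    + (1 ℕ.+ (#10 s ℕ.+ ends1 s) ℕ.+ (#10 s ℕ.+ ends1 s) C 2)
      ≡⟨ cong (λ z → + (1 ℕ.+ z ℕ.+ z C 2)) (sym (numRuns≡ (deriv x))) ⟩
    + (1 ℕ.+ m ℕ.+ m C 2)
      ≡⟨ trans (pos-+ (1 ℕ.+ m) (m C 2)) (cong (_+ + (m C 2)) (pos-+ 1 m)) ⟩
    + 1 + + m + + (m C 2) ∎
    where open ≡-Reasoning

  A₂-ℤ : + A 2 x ≡ (+ #11 s + + #11 s * + #10 s) - + #110 s
  A₂-ℤ = trans (+-to-difference (A 2 x) (#110 s) (A-correction 2 x (dropCount-2-2 s)))
               (cong (_- + #110 s) (trans (pos-+ (#11 s) (#11 s ℕ.* #10 s))
                                          (cong (λ z → + #11 s + z) (pos-* (#11 s) (#10 s)))))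

  A₃-ℤ : + A 3 x ≡ + #11 s * + ends1 s - + ends11 s
  A₃-ℤ = trans (+-to-difference (A 3 x) (ends11 s) (A-correction 3 x (dropCount-2-3 s)))
               (cong (_- + ends11 s) (pos-* (#11 s) (ends1 s)))

  A₄-ℤ : + A 4 x ≡ + ((weight (deriv x) ℕ.∸ m) C 2) - + #111 s
  A₄-ℤ = trans (+-to-difference (A 4 x) (#111 s) (A-correction 4 x (dropCount-2-4 s)))
               (cong (λ z → + (z C 2) - + #111 s) (sym ω∸m≡#11))
    where
    ω∸m≡#11 : weight (deriv x) ℕ.∸ m ≡ #11 s
    ω∸m≡#11 = trans (cong (ℕ._∸ m) (weight≡numRuns+#11 (deriv x))) (m+n∸m≡n m (#11 s))

lemma4p3 : (n : ℕ) (x : Vec Bool (suc n)) →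
    let ω  = weight (deriv x)
        m  = numRuns (deriv x)
        m₁ = numRuns1 (deriv x)
    in ((+ (A 0 x)) + (+ (A 1 x)) ≡ + 1 + + m + + (m C 2))
     × ((+ (A 2 x)) + (+ (A 3 x)) ≡ (+ ω - + m) * (+ m + + 1) - (+ m - + m₁))
     × (+ (A 4 x) ≡ + ((ω Data.Nat.∸ m) C 2) - (+ ω - + m) + (+ m - + m₁))
lemma4p3 n x =
    A₀+A₁-ℤ x
  , A₂+A₃-formula (+ #10 s) (+ #11 s) (+ ends1 s) (+ #110 s) (+ ends11 s)
      (A₂-ℤ x) (A₃-ℤ x) (weight-ℤ v) (numRuns-ℤ v) (numRuns1-ℤ v)
  , A₄-formula {m = + numRuns v} (+ ((weight v ℕ.∸ numRuns v) C 2)) (+ #110 s) (+ ends11 s) (+ #111 s)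
      (A₄-ℤ x) (#11-ℤ v) (weight-ℤ v) (numRuns1-ℤ v)
  where
  v : Vec Bool n
  v = deriv x
  s : List Bool
  s = toList v
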